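{- Let $n$ be a positive integer, $a\in[n]$ and $U\subseteq[n]$. The elements of $\mathsf{S}(n,\langle a,U\rangle)$ are exactly the bipartitions $\mathbf{x}$ of $[n]$ such that (i) the set of isolated points of $\mathbf{x}$ is contained in $\{a\}$, and (ii) if the set of isolated points of $\mathbf{x}$ equals $\{a\}$, then $([n]\setminus U)\times\{a\}\subseteq\mathbf{x}$ and $\{a\}\times U\subseteq\mathbf{x}$.
   Context: $[n]=\{1,\dots,n\}$. $\mathrm{Bip}(n)$ is the set of bipartitions of $[n]$, i.e. transitive relations $\mathbf{x}\subseteq[n]\times[n]$ whose complement in $[n]\times[n]$ is also transitive, ordered by inclusion; it is a lattice whose join is the transitive closure of the union and whose least element is $\varnothing$. $\mathsf{G}(n)$ is the set of all $([n]\setminus V)\times V$ with $\varnothing\neq V\subsetneq[n]$; $\langle a,U\rangle=(\{a\}\cup([n]\setminus U))\times(\{a\}\cup U)$; $\mathsf{S}(n,\langle a,U\rangle)$ is the $(\vee,0)$-subsemilattice of $\mathrm{Bip}(n)$ generated by $\mathsf{G}(n)\cup\{\langle a,U\rangle\}$ (all joins in $\mathrm{Bip}(n)$ of finite subsets of this set, including $\varnothing$). An element $a\in[n]$ is an isolated point of a bipartition $\mathbf{x}$ if for each $i\in[n]$: ($(a,i)\in\mathbf{x}$ and $(i,a)\in\mathbf{x}$) iff $i=a$. -}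

module Defs where

open import Data.Nat using (ℕ)
open import Data.Fin using (Fin; _≟_)
open import Data.Fin.Subset using (Subset; _∈_; _∉_; ∁; Nonempty)
open import Data.Bool using (Bool; true; false; not; _∧_; _∨_; T)
open import Data.Vec using (lookup)
open import Data.List using (List; []; _∷_)
open import Data.List.Relation.Unary.All using (All)
open import Data.Product using (Σ; _×_; ∃)
open import Data.Sum using (_⊎_)
open import Relation.Nullary using (¬_)
open import Relation.Nullary.Decidable using (⌊_⌋)
open import Relation.Binary.PropositionalEquality using (_≡_)
open import Relation.Binary.Construct.Closure.Transitive using (TransClosure)
open import Function.Bundles using (_⇔_)

BRel : ℕ → Set
BRel n = Fin n → Fin n → Bool

_∋_,_ : ∀ {n} → BRel n → Fin n → Fin n → Set
x ∋ i , j = T (x i j)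

_≐_ : ∀ {n} → BRel n → BRel n → Set
x ≐ y = ∀ i j → x i j ≡ y i j

IsBip : ∀ {n} → BRel n → Set
IsBip {n} x =
  (∀ i j k → x ∋ i , j → x ∋ j , k → x ∋ i , k) ×
  (∀ i j k → ¬ (x ∋ i , j) → ¬ (x ∋ j , k) → ¬ (x ∋ i , k))

genRel : ∀ {n} → Subset n → BRel n
genRel V i j = not (lookup V i) ∧ lookup V j

-- ⟨a,U⟩ = ({a} ∪ ([n] \ U)) × ({a} ∪ U)
angle : ∀ {n} → Fin n → Subset n → BRel n
angle a U i j = (⌊ i ≟ a ⌋ ∨ not (lookup U i)) ∧ (⌊ j ≟ a ⌋ ∨ lookup U j)

InG : ∀ {n} → BRel n → Set
InG {n} r = ∃ λ (V : Subset n) → Nonempty V × Nonempty (∁ V) × (r ≐ genRel V)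

IsGenerator : ∀ {n} → Fin n → Subset n → BRel n → Set
IsGenerator a U r = InG r ⊎ (r ≐ angle a U)

unionL : ∀ {n} → List (BRel n) → BRel n
unionL []       i j = false
unionL (r ∷ rs) i j = r i j ∨ unionL rs i j

-- join in Bip(n) of a finite family: transitive closure of the union
JoinL : ∀ {n} → List (BRel n) → Fin n → Fin n → Set
JoinL rs = TransClosure (λ i j → unionL rs ∋ i , j)

-- x ∈ S(n,⟨a,U⟩): x is the join of a finite subset of G(n) ∪ {⟨a,U⟩}
InS : ∀ {n} → Fin n → Subset n → BRel n → Set
InS {n} a U x =
  ∃ λ (rs : List (BRel n)) →
    All (IsGenerator a U) rs × (∀ i j → (x ∋ i , j) ⇔ JoinL rs i j)

IsIsolated : ∀ {n} → BRel n → Fin n → Set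
IsIsolated x b = ∀ i → ((x ∋ b , i) × (x ∋ i , b)) ⇔ (i ≡ b)

module Submission where

-- Every generator, in G(n) or ⟨a,U⟩, is a "rectangle" A × B whose sides cover [n];
-- such a relation is cotransitive (x∋i,k implies x∋i,j or x∋j,k), and cotransitivity
-- survives finite unions and transitive closure.  Hence every join x of generators is
-- transitive with transitive complement, i.e. a bipartition.  A loop x∋b,b at an
-- isolated point b of such a join must already be a loop of one generator; elements of
-- G(n) have no loops and ⟨a,U⟩ only the loop at a, so b = a and ⟨a,U⟩ occurs in the
-- join, which gives condition (ii).
--
-- Conversely, for a bipartition x we take the generators ([n] ∖ V) × V with V the
-- strict successors of some i, plus ⟨a,U⟩ when it lies below x.  All of them lie
-- below x, so their join does too.  Every off-diagonal pair of x is covered by a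
-- successor generator; a loop x∋p,p either goes through a 2-cycle p → k → p, or p is
-- isolated, hence p = a, and then condition (ii) puts ⟨a,U⟩ below x, supplying the loop.

open import Defs
open import Data.Nat using (ℕ; _≤_)
open import Data.Fin using (Fin; _≟_)
open import Data.Fin.Subset using (Subset; _∈_; _∉_; Nonempty)
open import Data.Fin.Subset.Properties using (_∈?_; nonempty?; x∉p⇒x∈∁p)
open import Data.Fin.Properties using (any?; all?)
open import Data.Bool using (Bool; true; false; not; T)
open import Data.Bool.Properties using (T-≡; T-∧; T-∨)
open import Data.Unit using (tt)
open import Data.Empty using (⊥-elim)
open import Data.Vec using (lookup; tabulate)
open import Data.Vec.Properties using (lookup∘tabulate; lookup⇒[]=; []=⇒lookup)
open import Data.List using (List; _∷_; map; filter; allFin)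
import Data.List.Relation.Unary.All as All
open All using (All; _∷_)
open import Data.List.Relation.Unary.All.Properties using (map⁺; all-filter; filter⁺)
open import Data.List.Relation.Unary.Any using (Any; here; there)
open import Data.List.Membership.Propositional using (find; lose) renaming (_∈_ to _∈ₗ_)
open import Data.List.Membership.Propositional.Properties using (∈-map⁺; ∈-filter⁺; ∈-allFin)
open import Data.Product using (_×_; _,_; proj₁; proj₂; ∃)
open import Data.Product.Function.NonDependent.Propositional using (_×-⇔_)
open import Data.Sum using (_⊎_; inj₁; inj₂) renaming ([_,_] to either)
open import Data.Sum.Function.Propositional using (_⊎-⇔_)
open import Relation.Nullary using (¬_; Dec; yes; no; ¬?)
open import Relation.Nullary.Decidable
  using (⌊_⌋; toWitness; fromWitness; T?; _×-dec_; _→-dec_; decidable-stable)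
open import Relation.Binary.PropositionalEquality using (_≡_; _≢_; refl; sym; subst)
open import Relation.Binary.Construct.Closure.Transitive using (TransClosure; [_]; _∷_; _++_)
open import Function using (_∘_)
open import Function.Bundles using (_⇔_; mk⇔; Equivalence)
open import Function.Properties.Equivalence using () renaming (trans to ⇔-trans; sym to ⇔-sym)

open Equivalence using (to; from)

dec-⊎ : {P : Set} → Dec P → P ⊎ ¬ P
dec-⊎ (yes p) = inj₁ p
dec-⊎ (no ¬p) = inj₂ ¬p

Cotransitive : {X : Set} → (X → X → Set) → Set
Cotransitive R = ∀ {i k} → R i k → ∀ j → R i j ⊎ R j k

Rect : {X : Set} → (X → Set) → (X → Set) → X → X → Set
Rect A B i j = A i × B j

rect-cotransitive : {X : Set} {A B : X → Set} → (∀ j → A j ⊎ B j) → Cotransitive (Rect A B)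
rect-cotransitive cover (Ai , Bk) j with cover j
... | inj₁ Aj = inj₂ (Aj , Bk)
... | inj₂ Bj = inj₁ (Ai , Bj)

cotransitive-⇔ : {X : Set} {R S : X → X → Set} →
  (∀ i j → R i j ⇔ S i j) → Cotransitive S → Cotransitive R
cotransitive-⇔ R⇔S coS {i} {k} rik j =
  Data.Sum.map (from (R⇔S i j)) (from (R⇔S j k)) (coS (to (R⇔S i k) rik) j)

closure-cotransitive : {X : Set} {R : X → X → Set} → Cotransitive R → Cotransitive (TransClosure R)
closure-cotransitive co [ rik ] j = Data.Sum.map [_] [_] (co rik j)
closure-cotransitive co (rim ∷ mk) j = Data.Sum.map [_] (_∷ mk) (co rim j)

closure-loop : {X : Set} {R : X → X → Set} {b : X} → TransClosure R b b →
  (∀ {m} → TransClosure R b m → TransClosure R m b → m ≡ b) → R b b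
closure-loop [ rbb ] _ = rbb
closure-loop {R = R} (rbm ∷ mb) mutual≡b = subst (R _) (mutual≡b [ rbm ] mb) rbm

closure-least : {X : Set} {R S : X → X → Set} →
  (∀ {i j k} → S i j → S j k → S i k) → (∀ {i j} → R i j → S i j) →
  ∀ {i j} → TransClosure R i j → S i j
closure-least _ R⊆S [ rij ] = R⊆S rij
closure-least trans R⊆S (rim ∷ mj) = trans (R⊆S rim) (closure-least trans R⊆S mj)

module _ {n : ℕ} where

  ⟦_⟧ : BRel n → Fin n → Fin n → Set
  ⟦ x ⟧ i j = x ∋ i , j

  _⊆ᵣ_ : BRel n → BRel n → Set
  r ⊆ᵣ x = ∀ i j → r ∋ i , j → x ∋ i , j

  _⊆ᵣ?_ : (r x : BRel n) → Dec (r ⊆ᵣ x)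
  r ⊆ᵣ? x = all? (λ i → all? (λ j → T? (r i j) →-dec T? (x i j)))

  ≐⇒⇔ : {r s : BRel n} → r ≐ s → ∀ i j → r ∋ i , j ⇔ s ∋ i , j
  ≐⇒⇔ r≐s i j = mk⇔ (subst T (r≐s i j)) (subst T (sym (r≐s i j)))

  T-not : {b : Bool} → T (not b) ⇔ (¬ T b)
  T-not {true} = mk⇔ (λ ()) (λ ¬t → ¬t tt)
  T-not {false} = mk⇔ (λ _ ()) (λ _ → tt)

  ∈⇔T : {i : Fin n} {V : Subset n} → i ∈ V ⇔ T (lookup V i)
  ∈⇔T {i} {V} = mk⇔ (from T-≡ ∘ []=⇒lookup) (lookup⇒[]= i V ∘ to T-≡)

  ∉⇔T : {i : Fin n} {V : Subset n} → i ∉ V ⇔ T (not (lookup V i))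
  ∉⇔T = mk⇔ (λ i∉V → from T-not (i∉V ∘ from ∈⇔T)) (λ t → to T-not t ∘ to ∈⇔T)

  ≡⇔T : {i a : Fin n} → i ≡ a ⇔ T ⌊ i ≟ a ⌋
  ≡⇔T = mk⇔ fromWitness toWitness

  union⇒any : (rs : List (BRel n)) {i j : Fin n} → unionL rs ∋ i , j → Any (λ r → r ∋ i , j) rs
  union⇒any (r ∷ rs) rsij with to (T-∨ {r _ _}) rsij
  ... | inj₁ rij = here rij
  ... | inj₂ rsij′ = there (union⇒any rs rsij′)

  any⇒union : {rs : List (BRel n)} {i j : Fin n} → Any (λ r → r ∋ i , j) rs → unionL rs ∋ i , j
  any⇒union {r ∷ _} (here rij) = from (T-∨ {r _ _}) (inj₁ rij)
  any⇒union {r ∷ _} (there rsij) = from (T-∨ {r _ _}) (inj₂ (any⇒union rsij))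

  union-cotransitive : {rs : List (BRel n)} → All (Cotransitive ∘ ⟦_⟧) rs → Cotransitive ⟦ unionL rs ⟧
  union-cotransitive {rs} cos rik j with find (union⇒any rs rik)
  ... | r , r∈rs , rik′ =
    Data.Sum.map (any⇒union ∘ lose r∈rs) (any⇒union ∘ lose r∈rs) (All.lookup cos r∈rs rik′ j)

  union-below : {rs : List (BRel n)} {x : BRel n} → All (_⊆ᵣ x) rs → unionL rs ⊆ᵣ x
  union-below {rs} below i j rsij with find (union⇒any rs rsij)
  ... | r , r∈rs , rij = All.lookup below r∈rs i j rij

module _ {n : ℕ} {x : BRel n} where

  -- For the decidable relation x, transitivity of the complement is cotransitivity.
  bip-cotransitive : IsBip x → Cotransitive ⟦ x ⟧
  bip-cotransitive (_ , co) {i} {k} xik j with T? (x i j) | T? (x j k)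
  ... | yes xij | _ = inj₁ xij
  ... | no _ | yes xjk = inj₂ xjk
  ... | no ¬xij | no ¬xjk = ⊥-elim (co i j k ¬xij ¬xjk xik)

  closure-isBip : {R : Fin n → Fin n → Set} → Cotransitive R →
    (∀ i j → x ∋ i , j ⇔ TransClosure R i j) → IsBip x
  closure-isBip coR x≅R⁺ =
    (λ i j k xij xjk → from (x≅R⁺ i k) (to (x≅R⁺ i j) xij ++ to (x≅R⁺ j k) xjk)) ,
    (λ i j k ¬xij ¬xjk xik →
      either (¬xij ∘ from (x≅R⁺ i j)) (¬xjk ∘ from (x≅R⁺ j k))
        (closure-cotransitive coR (to (x≅R⁺ i k) xik) j))

  isolated-loop : {R : Fin n → Fin n → Set} → (∀ i j → x ∋ i , j ⇔ TransClosure R i j) →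
    ∀ {b} → IsIsolated x b → R b b
  isolated-loop x≅R⁺ {b} iso = closure-loop (to (x≅R⁺ b b) (proj₁ (from (iso b) refl)))
    (λ {m} bm mb → to (iso m) (from (x≅R⁺ b m) bm , from (x≅R⁺ m b) mb))

  cycle-or-isolated : ∀ {p} → x ∋ p , p →
    (∃ λ k → k ≢ p × x ∋ p , k × x ∋ k , p) ⊎ IsIsolated x p
  cycle-or-isolated {p} xpp with any? (λ k → ¬? (k ≟ p) ×-dec T? (x p k) ×-dec T? (x k p))
  ... | yes cycle = inj₁ cycle
  ... | no ¬cycle = inj₂ λ k → mk⇔
    (λ (xpk , xkp) → decidable-stable (k ≟ p) (λ k≢p → ¬cycle (k , k≢p , xpk , xkp)))
    (λ { refl → xpp , xpp })

genRel-rect : {n : ℕ} (V : Subset n) {i j : Fin n} → genRel V ∋ i , j ⇔ Rect (_∉ V) (_∈ V) i j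
genRel-rect V = ⇔-trans T-∧ (⇔-sym ∉⇔T ×-⇔ ⇔-sym ∈⇔T)

successors : {n : ℕ} → BRel n → Fin n → Subset n
successors x i = tabulate (λ q → ⌊ T? (x i q) ×-dec ¬? (q ≟ i) ⌋)

module _ {n : ℕ} {x : BRel n} where

  ∈-successors : ∀ {i q} → q ∈ successors x i ⇔ (x ∋ i , q × q ≢ i)
  ∈-successors {i} {q} = ⇔-trans ∈⇔T (mk⇔
    (toWitness ∘ subst T (lookup∘tabulate _ q))
    (subst T (sym (lookup∘tabulate _ q)) ∘ fromWitness))

  -- i is not among its own strict successors V, so if V is nonempty then ([n] ∖ V) × V ∈ G(n).
  successor-generator : ∀ {i} → Nonempty (successors x i) → InG (genRel (successors x i))
  successor-generator {i} nonempty =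
    successors x i , nonempty , (i , x∉p⇒x∈∁p (λ i∈ → proj₂ (to ∈-successors i∈) refl)) , λ _ _ → refl

  -- For a bipartition x the successor generator of i is below x: given q a successor of i
  -- and p not one, either p = i or ¬ x∋i,p, and cotransitivity at i,q yields x∋p,q.
  successor-below : IsBip x → ∀ i → genRel (successors x i) ⊆ᵣ x
  successor-below bip i p q gpq with to (genRel-rect (successors x i)) gpq
  ... | p∉V , q∈V with to ∈-successors q∈V
  ... | xiq , _ with bip-cotransitive bip xiq p | p ≟ i
  ...   | inj₂ xpq | _ = xpq
  ...   | inj₁ _ | yes refl = xiq
  ...   | inj₁ xip | no p≢i = ⊥-elim (p∉V (from ∈-successors (xip , p≢i)))

  successor-covers : ∀ {p q} → x ∋ p , q → q ≢ p → genRel (successors x p) ∋ p , q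
  successor-covers xpq q≢p = from (genRel-rect _)
    ((λ p∈ → proj₂ (to ∈-successors p∈) refl) , from ∈-successors (xpq , q≢p))

successorGenerators : {n : ℕ} → BRel n → List (BRel n)
successorGenerators {n} x = map (genRel ∘ successors x) (filter (nonempty? ∘ successors x) (allFin n))

module _ {n : ℕ} {x : BRel n} where

  successorGenerators-inG : All InG (successorGenerators x)
  successorGenerators-inG =
    map⁺ (All.map (successor-generator {x = x}) (all-filter (nonempty? ∘ successors x) (allFin n)))

  successorGenerators-covers : ∀ {p q} → x ∋ p , q → q ≢ p → genRel (successors x p) ∈ₗ successorGenerators x
  successorGenerators-covers {p} {q} xpq q≢p = ∈-map⁺ (genRel ∘ successors x)
    (∈-filter⁺ (nonempty? ∘ successors x) (∈-allFin p) (q , from (∈-successors {x = x}) (xpq , q≢p)))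

module _ {n : ℕ} (a : Fin n) (U : Subset n) where

  AngleSource AngleTarget : Fin n → Set
  AngleSource i = i ≡ a ⊎ i ∉ U
  AngleTarget j = j ≡ a ⊎ j ∈ U

  angle-rect : ∀ {i j} → angle a U ∋ i , j ⇔ Rect AngleSource AngleTarget i j
  angle-rect = ⇔-trans T-∧ (⇔-trans T-∨ (⇔-sym ≡⇔T ⊎-⇔ ⇔-sym ∉⇔T) ×-⇔ ⇔-trans T-∨ (⇔-sym ≡⇔T ⊎-⇔ ⇔-sym ∈⇔T))

  angle-column : ∀ i → i ∉ U → angle a U ∋ i , a
  angle-column i i∉U = from angle-rect (inj₂ i∉U , inj₁ refl)

  angle-row : ∀ j → j ∈ U → angle a U ∋ a , j
  angle-row j j∈U = from angle-rect (inj₁ refl , inj₂ j∈U)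

  -- Every generator is a rectangle whose sides cover [n], hence cotransitive.
  generator-cotransitive : ∀ {r} → IsGenerator a U r → Cotransitive ⟦ r ⟧
  generator-cotransitive (inj₁ (V , _ , _ , r≐V)) =
    cotransitive-⇔ (λ i j → ⇔-trans (≐⇒⇔ r≐V i j) (genRel-rect V {i} {j}))
      (rect-cotransitive (λ j → Data.Sum.swap (dec-⊎ (j ∈? V))))
  generator-cotransitive (inj₂ r≐angle) =
    cotransitive-⇔ (λ i j → ⇔-trans (≐⇒⇔ r≐angle i j) (angle-rect {i} {j}))
      (rect-cotransitive (λ j → Data.Sum.map inj₂ inj₂ (Data.Sum.swap (dec-⊎ (j ∈? U)))))

  -- The sides of ([n] ∖ V) × V are disjoint and those of ⟨a,U⟩ meet in a,
  -- so a loop of a generator is the loop of ⟨a,U⟩ at a.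
  generator-loop : ∀ {r b} → IsGenerator a U r → r ∋ b , b → b ≡ a × r ≐ angle a U
  generator-loop {b = b} (inj₁ (V , _ , _ , r≐V)) rbb with to (genRel-rect V) (to (≐⇒⇔ r≐V b b) rbb)
  ... | b∉V , b∈V = ⊥-elim (b∉V b∈V)
  generator-loop {b = b} (inj₂ r≐angle) rbb with to (angle-rect {b} {b}) (to (≐⇒⇔ r≐angle b b) rbb)
  ... | inj₁ b≡a , _ = b≡a , r≐angle
  ... | inj₂ _ , inj₁ b≡a = b≡a , r≐angle
  ... | inj₂ b∉U , inj₂ b∈U = ⊥-elim (b∉U b∈U)

  union-loop : ∀ {rs b} → All (IsGenerator a U) rs → unionL rs ∋ b , b →
    b ≡ a × angle a U ⊆ᵣ unionL rs
  union-loop {rs} gens rsbb with find (union⇒any rs rsbb)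
  ... | r , r∈rs , rbb with generator-loop (All.lookup gens r∈rs) rbb
  ... | b≡a , r≐angle = b≡a , λ i j aij → any⇒union (lose r∈rs (from (≐⇒⇔ r≐angle i j) aij))

  angle-below : {x : BRel n} → IsBip x → x ∋ a , a →
    (∀ i → i ∉ U → x ∋ i , a) → (∀ j → j ∈ U → x ∋ a , j) → angle a U ⊆ᵣ x
  angle-below bip xaa column row i j aij with to (angle-rect {i} {j}) aij
  ... | inj₁ refl , inj₁ refl = xaa
  ... | inj₁ refl , inj₂ j∈U = row j j∈U
  ... | inj₂ i∉U , inj₁ refl = column i i∉U
  ... | inj₂ i∉U , inj₂ j∈U = proj₁ bip i a j (column i i∉U) (row j j∈U)

  IsolatedAtMostA : BRel n → Set
  IsolatedAtMostA x = ∀ b → IsIsolated x b → b ≡ a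

  AngleCondition : BRel n → Set
  AngleCondition x = (∀ b → IsIsolated x b ⇔ (b ≡ a)) →
    (∀ i → i ∉ U → x ∋ i , a) × (∀ j → j ∈ U → x ∋ a , j)

  isolated-angle-below : {x : BRel n} → IsBip x → IsolatedAtMostA x → AngleCondition x →
    ∀ {p} → IsIsolated x p → p ≡ a × angle a U ⊆ᵣ x
  isolated-angle-below {x} bip isolated≡a angleCondition {p} iso with isolated≡a p iso
  ... | refl =
    let column , row = angleCondition (λ b → mk⇔ (isolated≡a b) λ { refl → iso })
    in refl , angle-below bip (proj₁ (from (iso a) refl)) column row

  module JoinOfGenerators {x : BRel n} {rs : List (BRel n)} (gens : All (IsGenerator a U) rs)
                          (x≅join : ∀ i j → x ∋ i , j ⇔ JoinL rs i j) where

    join-isBip : IsBip x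
    join-isBip = closure-isBip (union-cotransitive (All.map generator-cotransitive gens)) x≅join

    join-isolated : IsolatedAtMostA x
    join-isolated b iso = proj₁ (union-loop gens (isolated-loop x≅join iso))

    join-angle : AngleCondition x
    join-angle isolated⇔a = (λ i i∉U → inJoin (angle-column i i∉U)) , (λ j j∈U → inJoin (angle-row j j∈U))
      where
        angle⊆union : angle a U ⊆ᵣ unionL rs
        angle⊆union = proj₂ (union-loop gens (isolated-loop x≅join (from (isolated⇔a a) refl)))

        inJoin : ∀ {i j} → angle a U ∋ i , j → x ∋ i , j
        inJoin {i} {j} aij = from (x≅join i j) [ angle⊆union i j aij ]

  generatorsBelow : BRel n → List (BRel n)
  generatorsBelow x = filter (_⊆ᵣ? x) (angle a U ∷ successorGenerators x)

  generatorsBelow-generators : ∀ {x} → All (IsGenerator a U) (generatorsBelow x)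
  generatorsBelow-generators {x} =
    filter⁺ (_⊆ᵣ? x) (inj₂ (λ _ _ → refl) ∷ All.map inj₁ successorGenerators-inG)

  join-generatorsBelow : {x : BRel n} → IsBip x → IsolatedAtMostA x → AngleCondition x →
    ∀ i j → x ∋ i , j ⇔ JoinL (generatorsBelow x) i j
  join-generatorsBelow {x} bip isolated≡a angleCondition i j =
    mk⇔ covered (closure-least (proj₁ bip _ _ _) (union-below below _ _))
    where
      below : All (_⊆ᵣ x) (generatorsBelow x)
      below = all-filter (_⊆ᵣ? x) (angle a U ∷ successorGenerators x)

      step : ∀ {r p q} → r ∈ₗ generatorsBelow x → r ∋ p , q → JoinL (generatorsBelow x) p q
      step r∈gens rpq = [ any⇒union (lose r∈gens rpq) ]

      offDiagonal : ∀ {p q} → x ∋ p , q → q ≢ p → JoinL (generatorsBelow x) p q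
      offDiagonal {p} xpq q≢p =
        step (∈-filter⁺ (_⊆ᵣ? x) (there (successorGenerators-covers {x = x} xpq q≢p)) (successor-below bip p))
             (successor-covers {x = x} xpq q≢p)

      -- A loop is a 2-cycle through the successor generators, or sits at an isolated
      -- point, which is a, where ⟨a,U⟩ supplies it.
      loop : ∀ {p} → x ∋ p , p → JoinL (generatorsBelow x) p p
      loop xpp with cycle-or-isolated {x = x} xpp
      ... | inj₁ (k , k≢p , xpk , xkp) = offDiagonal xpk k≢p ++ offDiagonal xkp (k≢p ∘ sym)
      ... | inj₂ iso with isolated-angle-below {x = x} bip isolated≡a angleCondition iso
      ... | refl , angle⊆x =
        step (∈-filter⁺ (_⊆ᵣ? x) (here refl) angle⊆x) (from angle-rect (inj₁ refl , inj₁ refl))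

      covered : x ∋ i , j → JoinL (generatorsBelow x) i j
      covered xij with j ≟ i
      ... | yes refl = loop xij
      ... | no j≢i = offDiagonal xij j≢i

proposition9p5 : (n : ℕ) → 1 ≤ n → (a : Fin n) → (U : Subset n) → (x : BRel n) →
    InS a U x ⇔
      (IsBip x ×
       (∀ b → IsIsolated x b → b ≡ a) ×
       ((∀ b → IsIsolated x b ⇔ (b ≡ a)) →
          (∀ i → i ∉ U → x ∋ i , a) × (∀ j → j ∈ U → x ∋ a , j)))
proposition9p5 n _ a U x = mk⇔ inS⇒conditions conditions⇒inS
  where
    inS⇒conditions : InS a U x → IsBip x × IsolatedAtMostA a U x × AngleCondition a U x
    inS⇒conditions (rs , gens , x≅join) =
      let open JoinOfGenerators a U gens x≅join in join-isBip , join-isolated , join-angle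

    conditions⇒inS : IsBip x × IsolatedAtMostA a U x × AngleCondition a U x → InS a U x
    conditions⇒inS (bip , isolated≡a , angleCondition) =
      generatorsBelow a U x , generatorsBelow-generators a U ,
      join-generatorsBelow a U bip isolated≡a angleCondition
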